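{- Let $\Omega$ be a finite set. Then for every $1\leq k\leq|\Omega|$, the $k$-uniform clutter $\mathcal{U}_{k,\Omega}$ is both an $\mathcal{R}_2$-forcing clutter and an $\mathcal{R}_2$-immune clutter; that is, there exist hypergraphs $\mathcal{H}$ and $\mathcal{H}'$ with vertex set $\Omega$ such that $\mathcal{F}_2(\mathcal{H})=\mathcal{U}_{k,\Omega}$ and $\mathcal{I}_2(\mathcal{H}')=\mathcal{U}_{k,\Omega}$.
   Context: For a finite set $\Omega$, $\mathcal{U}_{k,\Omega}=\{A\subseteq\Omega: |A|=k\}$. A hypergraph $\mathcal{H}$ on $\Omega$ has vertex set $\Omega$ and a clutter of hyperedges (subsets of $\Omega$, none containing another). Vertices are colored black or white. Rule $\mathcal{R}_2$: at each step, a non-empty set $X$ of black vertices contained in a hyperedge $E$, such that $X$ is not contained in any other hyperedge containing white vertices, forces all white vertices of $E$ to become black; iterating until no change is possible from an initial black set $B$ gives a final black set $\mathcal{R}_2^\ast(B)$ independent of the order of steps. An $\mathcal{R}_2$-forcing set is a non-empty $F\subseteq\Omega$ with $\mathcal{R}_2^\ast(F)=\Omega$; an $\mathcal{R}_2$-immune set is a non-empty $I\subseteq\Omega$ with $\mathcal{R}_2^\ast(\Omega\setminus I)=\Omega\setminus I$. $\mathcal{F}_2(\mathcal{H})$ and $\mathcal{I}_2(\mathcal{H})$ denote the families of inclusion-minimal $\mathcal{R}_2$-forcing sets and inclusion-minimal $\mathcal{R}_2$-immune sets. -}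

module Defs where

open import Data.Nat using (ℕ)
open import Data.Fin using (Fin)
open import Data.Fin.Subset using (Subset; _∈_; _∉_; _⊆_; ∁; Nonempty; ∣_∣)
open import Data.List using (List)
import Data.List.Membership.Propositional as LM
open import Data.Product using (_×_)
open import Relation.Binary.PropositionalEquality using (_≡_; _≢_)

record Hypergraph (n : ℕ) : Set where
  constructor mkHypergraph
  field
    edges   : List (Subset n)
    clutter : ∀ {E E′} → E LM.∈ edges → E′ LM.∈ edges → E ⊆ E′ → E ≡ E′
open Hypergraph public

data R2* {n : ℕ} (H : Hypergraph n) (B : Subset n) : Fin n → Set where
  init  : ∀ {v} → v ∈ B → R2* H B v
  force : ∀ {v} (E X : Subset n) → E LM.∈ edges H → Nonempty X → X ⊆ E →
          (∀ {x} → x ∈ X → R2* H B x) →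
          (∀ {E′} → E′ LM.∈ edges H → E′ ≢ E → X ⊆ E′ → ∀ {w} → w ∈ E′ → R2* H B w) →
          v ∈ E → R2* H B v

R2-forcing : ∀ {n} → Hypergraph n → Subset n → Set
R2-forcing H F = Nonempty F × (∀ v → R2* H F v)

R2-immune : ∀ {n} → Hypergraph n → Subset n → Set
R2-immune H I = Nonempty I × (∀ v → R2* H (∁ I) v → v ∉ I)

Minimal : ∀ {n} → (Subset n → Set) → Subset n → Set
Minimal P S = P S × (∀ T → T ⊆ S → P T → T ≡ S)

F₂≡U : ∀ {n} → Hypergraph n → ℕ → Set
F₂≡U H k = ∀ S → (Minimal (R2-forcing H) S → ∣ S ∣ ≡ k) × (∣ S ∣ ≡ k → Minimal (R2-forcing H) S)

I₂≡U : ∀ {n} → Hypergraph n → ℕ → Set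
I₂≡U H k = ∀ S → (Minimal (R2-immune H) S → ∣ S ∣ ≡ k) × (∣ S ∣ ≡ k → Minimal (R2-immune H) S)

{-# OPTIONS --safe #-}
module Submission where

-- Call H an s-threshold hypergraph if every black set of more than s vertices forces
-- all of Ω, while no R2 step applies to a black set of at most s vertices. The minimal
-- forcing sets of such an H are exactly the (s+1)-sets and, since I is immune iff its
-- complement is R2-closed, its minimal immune sets are exactly the (n ∸ s)-sets. So it
-- suffices to build an s-threshold hypergraph for every s < n: the single hyperedge Ω
-- for s = 0, no hyperedges for s = n ∸ 1, and otherwise, with an apex vertex, the base
-- Ω ∖ {apex} together with the cones {apex} ∪ T over all s-subsets T of the base.

open import Defs
open import Data.Nat using (ℕ; zero; suc; _≤_; _<_; _∸_; _+_; z≤n; s≤s; _≤?_; _<?_)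
open import Data.Nat.Properties
open import Data.Fin using () renaming (zero to fzero; suc to fsuc)
open import Data.Fin.Subset hiding (⊥)
open import Data.Fin.Subset.Properties
open import Data.Vec using ([]; _∷_; here; there; tail)
open import Data.List using (List; filter; _++_) renaming ([] to []ᴸ; _∷_ to _∷ᴸ_; map to mapᴸ)
open import Data.List.Membership.Propositional using () renaming (_∈_ to _∈ᴸ_)
open import Data.List.Membership.Propositional.Properties using (∈-map⁺; ∈-map⁻; ∈-++⁺ˡ; ∈-++⁺ʳ; ∈-filter⁺; ∈-filter⁻)
open import Data.List.Relation.Unary.Any using () renaming (here to hereᴸ; there to thereᴸ)
open import Data.Product using (Σ; ∃; _×_; _,_; proj₁; proj₂)
open import Data.Sum using () renaming (map to map⊎)
open import Data.Empty using (⊥; ⊥-elim)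
open import Function using (id)
open import Relation.Nullary using (¬_; Dec; yes; no; contradiction)
open import Relation.Binary.PropositionalEquality using (_≡_; _≢_; refl; sym; trans; cong; subst)

∣p∪q∣≤∣p∣+∣q∣ : ∀ {n} (p q : Subset n) → ∣ p ∪ q ∣ ≤ ∣ p ∣ + ∣ q ∣
∣p∪q∣≤∣p∣+∣q∣ []            []            = z≤n
∣p∪q∣≤∣p∣+∣q∣ (inside ∷ p)  (inside ∷ q)  = s≤s (≤-trans (∣p∪q∣≤∣p∣+∣q∣ p q) (+-monoʳ-≤ ∣ p ∣ (n≤1+n _)))
∣p∪q∣≤∣p∣+∣q∣ (inside ∷ p)  (outside ∷ q) = s≤s (∣p∪q∣≤∣p∣+∣q∣ p q)
∣p∪q∣≤∣p∣+∣q∣ (outside ∷ p) (inside ∷ q)  =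
  subst (suc ∣ p ∪ q ∣ ≤_) (sym (+-suc ∣ p ∣ ∣ q ∣)) (s≤s (∣p∪q∣≤∣p∣+∣q∣ p q))
∣p∪q∣≤∣p∣+∣q∣ (outside ∷ p) (outside ∷ q) = ∣p∪q∣≤∣p∣+∣q∣ p q

∣p∪⁅x⁆∣≤1+∣p∣ : ∀ {n} (p : Subset n) x → ∣ p ∪ ⁅ x ⁆ ∣ ≤ suc ∣ p ∣
∣p∪⁅x⁆∣≤1+∣p∣ p x = ≤-trans (∣p∪q∣≤∣p∣+∣q∣ p ⁅ x ⁆)
  (≤-reflexive (trans (cong (∣ p ∣ +_) (∣⁅x⁆∣≡1 x)) (+-comm ∣ p ∣ 1)))

p⊆q⇒∣q∣≤∣p∣⇒p≡q : ∀ {n} {p q : Subset n} → p ⊆ q → ∣ q ∣ ≤ ∣ p ∣ → p ≡ q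
p⊆q⇒∣q∣≤∣p∣⇒p≡q {p = []}          {[]}          _   _  = refl
p⊆q⇒∣q∣≤∣p∣⇒p≡q {p = outside ∷ p} {outside ∷ q} p⊆q le =
  cong (outside ∷_) (p⊆q⇒∣q∣≤∣p∣⇒p≡q (drop-∷-⊆ p⊆q) le)
p⊆q⇒∣q∣≤∣p∣⇒p≡q {p = outside ∷ p} {inside ∷ q}  p⊆q le =
  contradiction (≤-trans le (p⊆q⇒∣p∣≤∣q∣ (drop-∷-⊆ p⊆q))) (<⇒≱ ≤-refl)
p⊆q⇒∣q∣≤∣p∣⇒p≡q {p = inside ∷ p}  {outside ∷ q} p⊆q le with p⊆q here
... | ()
p⊆q⇒∣q∣≤∣p∣⇒p≡q {p = inside ∷ p}  {inside ∷ q}  p⊆q le =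
  cong (inside ∷_) (p⊆q⇒∣q∣≤∣p∣⇒p≡q (drop-∷-⊆ p⊆q) (≤-pred le))

x∈p⇒0<∣p∣ : ∀ {n} {p : Subset n} {x} → x ∈ p → 0 < ∣ p ∣
x∈p⇒0<∣p∣ here                  = s≤s z≤n
x∈p⇒0<∣p∣ {p = b ∷ p} (there x∈p) = ≤-trans (x∈p⇒0<∣p∣ x∈p) (∣p∣≤∣x∷p∣ b p)

0<∣p∣⇒Nonempty : ∀ {n} (p : Subset n) → 0 < ∣ p ∣ → Nonempty p
0<∣p∣⇒Nonempty (inside ∷ p)  _   = fzero , here
0<∣p∣⇒Nonempty (outside ∷ p) 0<∣p∣ with 0<∣p∣⇒Nonempty p 0<∣p∣
... | x , x∈p = fsuc x , there x∈p

∣p∣<n⇒∃∉ : ∀ {n} (p : Subset n) → ∣ p ∣ < n → ∃ λ x → x ∉ p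
∣p∣<n⇒∃∉ (outside ∷ p) _ = fzero , λ ()
∣p∣<n⇒∃∉ (inside ∷ p)  lt with ∣p∣<n⇒∃∉ p (≤-pred lt)
... | x , x∉p = fsuc x , λ { (there x∈p) → x∉p x∈p }

p⊆q⇒p∪r⊆q∪r : ∀ {n} {p q : Subset n} (r : Subset n) → p ⊆ q → p ∪ r ⊆ q ∪ r
p⊆q⇒p∪r⊆q∪r {p = p} r p⊆q x∈p∪r = x∈p∪q⁺ (map⊎ p⊆q id (x∈p∪q⁻ p r x∈p∪r))

x∉p⇒p⊆∁⁅x⁆ : ∀ {n} {p : Subset n} {x} → x ∉ p → p ⊆ ∁ ⁅ x ⁆
x∉p⇒p⊆∁⁅x⁆ {p = p} {x} x∉p {y} y∈p = x∉p⇒x∈∁p λ y∈⁅x⁆ → x∉p (subst (_∈ p) (x∈⁅y⁆⇒x≡y x y∈⁅x⁆) y∈p)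

∃-⊆-⊆-∣∣≡ : ∀ {n} {A U : Subset n} {s} → A ⊆ U → ∣ A ∣ ≤ s → s ≤ ∣ U ∣ →
            ∃ λ T → A ⊆ T × T ⊆ U × ∣ T ∣ ≡ s
∃-⊆-⊆-∣∣≡ {A = []} {[]} {zero} _ _ _ = [] , id , id , refl
∃-⊆-⊆-∣∣≡ {A = inside ∷ A} {outside ∷ U} A⊆U _ _ with A⊆U here
... | ()
∃-⊆-⊆-∣∣≡ {A = outside ∷ A} {outside ∷ U} A⊆U le₁ le₂
  with ∃-⊆-⊆-∣∣≡ (drop-∷-⊆ A⊆U) le₁ le₂
... | T , A⊆T , T⊆U , ∣T∣≡s = outside ∷ T , out⊆ A⊆T , out⊆ T⊆U , ∣T∣≡s
∃-⊆-⊆-∣∣≡ {A = inside ∷ A} {inside ∷ U} {suc s} A⊆U le₁ le₂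
  with ∃-⊆-⊆-∣∣≡ (drop-∷-⊆ A⊆U) (≤-pred le₁) (≤-pred le₂)
... | T , A⊆T , T⊆U , ∣T∣≡s = inside ∷ T , in⊆in A⊆T , in⊆in T⊆U , cong suc ∣T∣≡s
∃-⊆-⊆-∣∣≡ {A = outside ∷ A} {inside ∷ U} {s} A⊆U le₁ le₂ with s ≤? ∣ U ∣
... | yes s≤∣U∣ with ∃-⊆-⊆-∣∣≡ (drop-∷-⊆ A⊆U) le₁ s≤∣U∣
...   | T , A⊆T , T⊆U , ∣T∣≡s = outside ∷ T , out⊆ A⊆T , out⊆ T⊆U , ∣T∣≡s
∃-⊆-⊆-∣∣≡ {A = outside ∷ A} {inside ∷ U} {zero}  A⊆U le₁ le₂ | no s≰∣U∣ = contradiction z≤n s≰∣U∣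
∃-⊆-⊆-∣∣≡ {A = outside ∷ A} {inside ∷ U} {suc s} A⊆U le₁ le₂ | no s≰∣U∣
  with ∃-⊆-⊆-∣∣≡ (drop-∷-⊆ A⊆U)
         (≤-trans (p⊆q⇒∣p∣≤∣q∣ (drop-∷-⊆ A⊆U)) (≤-pred (≰⇒> s≰∣U∣))) (≤-pred le₂)
... | T , A⊆T , T⊆U , ∣T∣≡s = inside ∷ T , out⊆ A⊆T , in⊆in T⊆U , cong suc ∣T∣≡s

∃-⊆-∣∣≡ : ∀ {n} (U : Subset n) {s} → s ≤ ∣ U ∣ → ∃ λ T → T ⊆ U × ∣ T ∣ ≡ s
∃-⊆-∣∣≡ {n} U s≤∣U∣ with ∃-⊆-⊆-∣∣≡ (⊥⊆ {p = U}) (≤-trans (≤-reflexive (∣⊥∣≡0 n)) z≤n) s≤∣U∣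
... | T , _ , T⊆U , ∣T∣≡s = T , T⊆U , ∣T∣≡s

minimal⇔∣∣≡ : ∀ {n} (P : Subset n → Set) (t : ℕ) →
  (∀ S → P S → t ≤ ∣ S ∣) → (∀ S → t ≤ ∣ S ∣ → P S) →
  ∀ S → (Minimal P S → ∣ S ∣ ≡ t) × (∣ S ∣ ≡ t → Minimal P S)
minimal⇔∣∣≡ P t P⇒t≤ t≤⇒P S = minimal⇒ , ⇒minimal
  where
  minimal⇒ : Minimal P S → ∣ S ∣ ≡ t
  minimal⇒ (PS , minimal) with ∃-⊆-∣∣≡ S (P⇒t≤ S PS)
  ... | T , T⊆S , ∣T∣≡t =
    trans (cong ∣_∣ (sym (minimal T T⊆S (t≤⇒P T (≤-reflexive (sym ∣T∣≡t)))))) ∣T∣≡t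
  ⇒minimal : ∣ S ∣ ≡ t → Minimal P S
  ⇒minimal ∣S∣≡t = t≤⇒P S (≤-reflexive (sym ∣S∣≡t)) , λ T T⊆S PT →
    p⊆q⇒∣q∣≤∣p∣⇒p≡q T⊆S (≤-trans (≤-reflexive ∣S∣≡t) (P⇒t≤ T PT))

Stable : ∀ {n} → Hypergraph n → Subset n → Set
Stable {n} H B = ∀ {E X : Subset n} → E ∈ᴸ edges H → Nonempty X → X ⊆ E → X ⊆ B →
  (∀ {E′} → E′ ∈ᴸ edges H → E′ ≢ E → X ⊆ E′ → E′ ⊆ B) → E ⊆ B

stable⇒R2*-closed : ∀ {n} {H : Hypergraph n} {B} → Stable H B → ∀ {v} → R2* H B v → v ∈ B
stable⇒R2*-closed stable (init v∈B) = v∈B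
stable⇒R2*-closed stable (force E X E∈H X≢∅ X⊆E X-black others-black v∈E) =
  stable E∈H X≢∅ X⊆E (λ x∈X → stable⇒R2*-closed stable (X-black x∈X))
    (λ E′∈H E′≢E X⊆E′ w∈E′ → stable⇒R2*-closed stable (others-black E′∈H E′≢E X⊆E′ w∈E′)) v∈E

record Threshold {n} (H : Hypergraph n) (s : ℕ) : Set where
  field
    large-forces : ∀ B → s < ∣ B ∣ → ∀ v → R2* H B v
    small-stable : ∀ B → ∣ B ∣ ≤ s → Stable H B

  small-closed : ∀ B → ∣ B ∣ ≤ s → ∀ {v} → R2* H B v → v ∈ B
  small-closed B ∣B∣≤s = stable⇒R2*-closed (small-stable B ∣B∣≤s)

threshold⇒F₂≡U : ∀ {n} (H : Hypergraph n) s → s < n → Threshold H s → F₂≡U H (suc s)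
threshold⇒F₂≡U H s s<n threshold = minimal⇔∣∣≡ (R2-forcing H) (suc s) forcing⇒ ⇒forcing
  where
  open Threshold threshold
  forcing⇒ : ∀ S → R2-forcing H S → s < ∣ S ∣
  forcing⇒ S (_ , forces) with s <? ∣ S ∣
  ... | yes s<∣S∣ = s<∣S∣
  ... | no s≮∣S∣ with ∣p∣<n⇒∃∉ S (≤-<-trans (≮⇒≥ s≮∣S∣) s<n)
  ...   | w , w∉S = contradiction (small-closed S (≮⇒≥ s≮∣S∣) (forces w)) w∉S
  ⇒forcing : ∀ S → s < ∣ S ∣ → R2-forcing H S
  ⇒forcing S s<∣S∣ = 0<∣p∣⇒Nonempty S (≤-<-trans z≤n s<∣S∣) , large-forces S s<∣S∣

threshold⇒I₂≡U : ∀ {n} (H : Hypergraph n) k → 1 ≤ k → k ≤ n → Threshold H (n ∸ k) → I₂≡U H k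
threshold⇒I₂≡U {n} H k 1≤k k≤n threshold = minimal⇔∣∣≡ (R2-immune H) k immune⇒ ⇒immune
  where
  open Threshold threshold
  immune⇒ : ∀ S → R2-immune H S → k ≤ ∣ S ∣
  immune⇒ S ((x , x∈S) , immune) with k ≤? ∣ S ∣
  ... | yes k≤∣S∣ = k≤∣S∣
  ... | no k≰∣S∣ = contradiction x∈S (immune x (large-forces (∁ S) n∸k<∣∁S∣ x))
    where
    n∸k<∣∁S∣ : n ∸ k < ∣ ∁ S ∣
    n∸k<∣∁S∣ = subst (n ∸ k <_) (sym (∣∁p∣≡n∸∣p∣ S)) (∸-monoʳ-< (≰⇒> k≰∣S∣) k≤n)
  ⇒immune : ∀ S → k ≤ ∣ S ∣ → R2-immune H S
  ⇒immune S k≤∣S∣ = 0<∣p∣⇒Nonempty S (≤-trans 1≤k k≤∣S∣) , λ v v∈R2* →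
    x∈∁p⇒x∉p (small-closed (∁ S) ∣∁S∣≤n∸k v∈R2*)
    where
    ∣∁S∣≤n∸k : ∣ ∁ S ∣ ≤ n ∸ k
    ∣∁S∣≤n∸k = subst (_≤ n ∸ k) (sym (∣∁p∣≡n∸∣p∣ S)) (∸-monoʳ-≤ n k≤∣S∣)

singleEdge : ∀ n → Hypergraph n
singleEdge n = mkHypergraph (⊤ ∷ᴸ []ᴸ) λ { (hereᴸ refl) (hereᴸ refl) _ → refl }

singleEdge-threshold : ∀ n → Threshold (singleEdge n) 0
singleEdge-threshold n = record { large-forces = large-forces ; small-stable = small-stable }
  where
  large-forces : ∀ B → 0 < ∣ B ∣ → ∀ v → R2* (singleEdge n) B v
  large-forces B 0<∣B∣ v = force ⊤ B (hereᴸ refl) (0<∣p∣⇒Nonempty B 0<∣B∣) ⊆⊤ init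
    (λ { (hereᴸ refl) ⊤≢⊤ → contradiction refl ⊤≢⊤ }) ∈⊤
  small-stable : ∀ B → ∣ B ∣ ≤ 0 → Stable (singleEdge n) B
  small-stable B ∣B∣≤0 _ (x , x∈X) _ X⊆B _ =
    contradiction (x∈p⇒0<∣p∣ (X⊆B x∈X)) (≤⇒≯ ∣B∣≤0)

noEdges : ∀ n → Hypergraph n
noEdges n = mkHypergraph []ᴸ λ ()

noEdges-threshold : ∀ m → Threshold (noEdges (suc m)) m
noEdges-threshold m = record { large-forces = large-forces ; small-stable = λ _ _ () }
  where
  large-forces : ∀ B → m < ∣ B ∣ → ∀ v → R2* (noEdges (suc m)) B v
  large-forces B m<∣B∣ v = init (subst (v ∈_) (sym (∣p∣≡n⇒p≡⊤ (≤-antisym (∣p∣≤n B) m<∣B∣))) ∈⊤)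

allSubsets : ∀ n → List (Subset n)
allSubsets zero    = [] ∷ᴸ []ᴸ
allSubsets (suc n) = mapᴸ (inside ∷_) (allSubsets n) ++ mapᴸ (outside ∷_) (allSubsets n)

allSubsets-complete : ∀ {n} (p : Subset n) → p ∈ᴸ allSubsets n
allSubsets-complete []           = hereᴸ refl
allSubsets-complete (inside ∷ p) = ∈-++⁺ˡ (∈-map⁺ (inside ∷_) (allSubsets-complete p))
allSubsets-complete {suc n} (outside ∷ p) =
  ∈-++⁺ʳ (mapᴸ (inside ∷_) (allSubsets n)) (∈-map⁺ (outside ∷_) (allSubsets-complete p))

subsetsOfSize : ∀ n → ℕ → List (Subset n)
subsetsOfSize n s = filter (λ T → ∣ T ∣ ≟ s) (allSubsets n)

module Cone (m s : ℕ) (0<s : 0 < s) (s<m : s < m) where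

  base : Subset (suc m)
  base = outside ∷ ⊤

  cone : Subset m → Subset (suc m)
  cone T = inside ∷ T

  coneEdges : List (Subset (suc m))
  coneEdges = base ∷ᴸ mapᴸ cone (subsetsOfSize m s)

  data IsEdge : Subset (suc m) → Set where
    isBase : IsEdge base
    isCone : ∀ T → ∣ T ∣ ≡ s → IsEdge (cone T)

  isEdge : ∀ {E} → E ∈ᴸ coneEdges → IsEdge E
  isEdge (hereᴸ refl) = isBase
  isEdge (thereᴸ E∈) with ∈-map⁻ cone E∈
  ... | T , T∈ , refl = isCone T (proj₂ (∈-filter⁻ (λ T → ∣ T ∣ ≟ s) {xs = allSubsets m} T∈))

  base∈ : base ∈ᴸ coneEdges
  base∈ = hereᴸ refl

  cone∈ : ∀ {T} → ∣ T ∣ ≡ s → cone T ∈ᴸ coneEdges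
  cone∈ {T} ∣T∣≡s =
    thereᴸ (∈-map⁺ cone (∈-filter⁺ (λ T → ∣ T ∣ ≟ s) (allSubsets-complete T) ∣T∣≡s))

  ⊤⊆p⇒s<∣p∣ : ∀ {p : Subset m} → ⊤ ⊆ p → s < ∣ p ∣
  ⊤⊆p⇒s<∣p∣ ⊤⊆p = <-≤-trans s<m (≤-trans (≤-reflexive (sym (∣⊤∣≡n m))) (p⊆q⇒∣p∣≤∣q∣ ⊤⊆p))

  edges-clutter : ∀ {E E′} → IsEdge E → IsEdge E′ → E ⊆ E′ → E ≡ E′
  edges-clutter isBase         isBase           _ = refl
  edges-clutter isBase         (isCone T ∣T∣≡s) E⊆E′ =
    contradiction (≤-reflexive ∣T∣≡s) (<⇒≱ (⊤⊆p⇒s<∣p∣ (drop-∷-⊆ E⊆E′)))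
  edges-clutter (isCone T _)   isBase           E⊆E′ with E⊆E′ here
  ... | ()
  edges-clutter (isCone T ∣T∣≡s) (isCone T′ ∣T′∣≡s) E⊆E′ =
    cong cone (p⊆q⇒∣q∣≤∣p∣⇒p≡q (drop-∷-⊆ E⊆E′) (≤-reflexive (trans ∣T′∣≡s (sym ∣T∣≡s))))

  H : Hypergraph (suc m)
  H = mkHypergraph coneEdges λ E∈ E′∈ → edges-clutter (isEdge E∈) (isEdge E′∈)

  ∷⊆inside∷ : ∀ {x} {p q : Subset m} → p ⊆ q → x ∷ p ⊆ inside ∷ q
  ∷⊆inside∷ p⊆q here          = here
  ∷⊆inside∷ p⊆q (there y∈p) = there (p⊆q y∈p)

  s≤∣⊤∣ : s ≤ ∣ ⊤ {m} ∣
  s≤∣⊤∣ = ≤-trans (<⇒≤ s<m) (≤-reflexive (sym (∣⊤∣≡n m)))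

  s≤∣tail∣ : ∀ b (B′ : Subset m) → s < ∣ b ∷ B′ ∣ → s ≤ ∣ B′ ∣
  s≤∣tail∣ inside  B′ s<∣B∣ = ≤-pred s<∣B∣
  s≤∣tail∣ outside B′ s<∣B∣ = <⇒≤ s<∣B∣

  cone⊆large : ∀ b {B′ T : Subset m} → s < ∣ b ∷ B′ ∣ → ∣ T ∣ ≡ s → B′ ⊆ T → cone T ⊆ b ∷ B′
  cone⊆large outside s<∣B∣ ∣T∣≡s B′⊆T =
    contradiction (≤-trans (p⊆q⇒∣p∣≤∣q∣ B′⊆T) (≤-reflexive ∣T∣≡s)) (<⇒≱ s<∣B∣)
  cone⊆large inside s<∣B∣ ∣T∣≡s B′⊆T = ⊆-reflexive (cong cone (sym
    (p⊆q⇒∣q∣≤∣p∣⇒p≡q B′⊆T (≤-trans (≤-reflexive ∣T∣≡s) (≤-pred s<∣B∣)))))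

  -- A large black set B meets the base in at least s vertices, so the base forces
  -- itself black; any s-subset of the base then forces its cone, i.e. the apex.
  large-forces : ∀ B → s < ∣ B ∣ → ∀ v → R2* H B v
  large-forces (b ∷ B′) s<∣B∣ = forces
    where
    B = b ∷ B′

    base-black : ∀ i → R2* H B (fsuc i)
    base-black i = force base (outside ∷ B′) base∈
      (0<∣p∣⇒Nonempty (outside ∷ B′) (<-≤-trans 0<s (s≤∣tail∣ b B′ s<∣B∣))) (out⊆ ⊆⊤) (λ { (there x∈B′) → init (there x∈B′) }) others (there ∈⊤)
      where
      others : ∀ {E′} → E′ ∈ᴸ coneEdges → E′ ≢ base → outside ∷ B′ ⊆ E′ → ∀ {w} → w ∈ E′ → R2* H B w
      others E′∈ E′≢base B′⊆E′ with isEdge E′∈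
      ... | isBase         = contradiction refl E′≢base
      ... | isCone T ∣T∣≡s = λ w∈E′ → init (cone⊆large b s<∣B∣ ∣T∣≡s (drop-∷-⊆ B′⊆E′) w∈E′)

    T₀ : Subset m
    T₀ = proj₁ (∃-⊆-∣∣≡ (⊤ {m}) s≤∣⊤∣)

    ∣T₀∣≡s : ∣ T₀ ∣ ≡ s
    ∣T₀∣≡s = proj₂ (proj₂ (∃-⊆-∣∣≡ (⊤ {m}) s≤∣⊤∣))

    apex-black : R2* H B fzero
    apex-black = force (cone T₀) (outside ∷ T₀) (cone∈ ∣T₀∣≡s)
      (0<∣p∣⇒Nonempty (outside ∷ T₀) (<-≤-trans 0<s (≤-reflexive (sym ∣T₀∣≡s))))
      (out⊆ ⊆-refl) (λ { (there _) → base-black _ }) others here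
      where
      others : ∀ {E′} → E′ ∈ᴸ coneEdges → E′ ≢ cone T₀ → outside ∷ T₀ ⊆ E′ → ∀ {w} → w ∈ E′ → R2* H B w
      others E′∈ E′≢cone T₀⊆E′ with isEdge E′∈
      ... | isBase         = λ { (there _) → base-black _ }
      ... | isCone T ∣T∣≡s = contradiction (cong cone (sym (p⊆q⇒∣q∣≤∣p∣⇒p≡q (drop-∷-⊆ T₀⊆E′)
                               (≤-reflexive (trans ∣T∣≡s (sym ∣T₀∣≡s)))))) E′≢cone

    forces : ∀ v → R2* H B v
    forces fzero    = apex-black
    forces (fsuc i) = base-black i

  -- Below the threshold at least two vertices w₁ ≢ w₂ lie outside B′, which leaves
  -- room for an s-superset of X′ avoiding any prescribed S and not inside B′.
  escape : ∀ {X′ B′ : Subset m} (S : Subset m) → X′ ⊆ B′ → ∣ B′ ∣ < s →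
           ∃ λ T → X′ ⊆ T × ∣ T ∣ ≡ s × T ≢ S × ¬ (T ⊆ B′)
  escape {X′} {B′} S X′⊆B′ ∣B′∣<s = pick (w₂ ∈? S)
    where
    W₁ = ∣p∣<n⇒∃∉ B′ (<-trans ∣B′∣<s s<m)
    w₁ = proj₁ W₁
    w₁∉B′ = proj₂ W₁
    W₂ = ∣p∣<n⇒∃∉ (B′ ∪ ⁅ w₁ ⁆) (≤-<-trans (∣p∪⁅x⁆∣≤1+∣p∣ B′ w₁) (≤-<-trans ∣B′∣<s s<m))
    w₂ = proj₁ W₂
    w₂∉B′ : w₂ ∉ B′
    w₂∉B′ w₂∈B′ = proj₂ W₂ (p⊆p∪q ⁅ w₁ ⁆ w₂∈B′)

    ∣X′∪⁅w⁆∣≤s : ∀ w → ∣ X′ ∪ ⁅ w ⁆ ∣ ≤ s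
    ∣X′∪⁅w⁆∣≤s w = ≤-trans (∣p∪⁅x⁆∣≤1+∣p∣ X′ w) (≤-trans (s≤s (p⊆q⇒∣p∣≤∣q∣ X′⊆B′)) ∣B′∣<s)

    s≤∣∁⁅w₂⁆∣ : s ≤ ∣ ∁ ⁅ w₂ ⁆ ∣
    s≤∣∁⁅w₂⁆∣ = subst (s ≤_) (sym (trans (∣∁p∣≡n∸∣p∣ ⁅ w₂ ⁆) (cong (m ∸_) (∣⁅x⁆∣≡1 w₂))))
                  (∸-monoˡ-≤ 1 s<m)

    P₁ = ∃-⊆-⊆-∣∣≡ (⊆-trans (p⊆q⇒p∪r⊆q∪r ⁅ w₁ ⁆ X′⊆B′) (x∉p⇒p⊆∁⁅x⁆ (proj₂ W₂)))
           (∣X′∪⁅w⁆∣≤s w₁) s≤∣∁⁅w₂⁆∣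
    T₁ = proj₁ P₁
    X′⊆T₁ : X′ ⊆ T₁
    X′⊆T₁ x∈X′ = proj₁ (proj₂ P₁) (p⊆p∪q ⁅ w₁ ⁆ x∈X′)
    w₁∈T₁ : w₁ ∈ T₁
    w₁∈T₁ = proj₁ (proj₂ P₁) (q⊆p∪q X′ ⁅ w₁ ⁆ (x∈⁅x⁆ w₁))
    w₂∉T₁ : w₂ ∉ T₁
    w₂∉T₁ w₂∈T₁ = x∈∁p⇒x∉p (proj₁ (proj₂ (proj₂ P₁)) w₂∈T₁) (x∈⁅x⁆ w₂)
    ∣T₁∣≡s = proj₂ (proj₂ (proj₂ P₁))

    P₂ = ∃-⊆-⊆-∣∣≡ ⊆⊤ (∣X′∪⁅w⁆∣≤s w₂) s≤∣⊤∣
    T₂ = proj₁ P₂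
    X′⊆T₂ : X′ ⊆ T₂
    X′⊆T₂ x∈X′ = proj₁ (proj₂ P₂) (p⊆p∪q ⁅ w₂ ⁆ x∈X′)
    w₂∈T₂ : w₂ ∈ T₂
    w₂∈T₂ = proj₁ (proj₂ P₂) (q⊆p∪q X′ ⁅ w₂ ⁆ (x∈⁅x⁆ w₂))
    ∣T₂∣≡s = proj₂ (proj₂ (proj₂ P₂))

    pick : Dec (w₂ ∈ S) → ∃ λ T → X′ ⊆ T × ∣ T ∣ ≡ s × T ≢ S × ¬ (T ⊆ B′)
    pick (yes w₂∈S) = T₁ , X′⊆T₁ , ∣T₁∣≡s , (λ T₁≡S → w₂∉T₁ (subst (w₂ ∈_) (sym T₁≡S) w₂∈S)) ,
                      λ T₁⊆B′ → w₁∉B′ (T₁⊆B′ w₁∈T₁)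
    pick (no w₂∉S)  = T₂ , X′⊆T₂ , ∣T₂∣≡s , (λ T₂≡S → w₂∉S (subst (w₂ ∈_) T₂≡S w₂∈T₂)) ,
                      λ T₂⊆B′ → w₂∉B′ (T₂⊆B′ w₂∈T₂)

  OthersBlack : Subset (suc m) → Subset (suc m) → Subset (suc m) → Set
  OthersBlack E X B = ∀ {E′} → E′ ∈ᴸ coneEdges → E′ ≢ E → X ⊆ E′ → E′ ⊆ B

  -- A step from B would need every other edge through X to be black. A white apex is
  -- contained in every cone over X; a black apex leaves fewer than s base vertices in B.
  no-step-below : ∀ {E X B} → IsEdge E → X ⊆ B → ∣ B ∣ ≤ s → OthersBlack E X B → ⊥
  no-step-below {X = x ∷ X′} {outside ∷ B′} isBase X⊆B ∣B∣≤s others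
    with ∃-⊆-⊆-∣∣≡ ⊆⊤ (≤-trans (p⊆q⇒∣p∣≤∣q∣ (drop-∷-⊆ X⊆B)) ∣B∣≤s) s≤∣⊤∣
  ... | T , X′⊆T , _ , ∣T∣≡s with others (cone∈ ∣T∣≡s) (λ ()) (∷⊆inside∷ X′⊆T) here
  ... | ()
  no-step-below {X = x ∷ X′} {inside ∷ B′} isBase X⊆B ∣B∣≤s others
    with escape ⊤ (drop-∷-⊆ X⊆B) ∣B∣≤s
  ... | T , X′⊆T , ∣T∣≡s , _ , T⊈B′ = T⊈B′ (drop-∷-⊆ (others (cone∈ ∣T∣≡s) (λ ()) (∷⊆inside∷ X′⊆T)))
  no-step-below {X = outside ∷ X′} {b ∷ B′} (isCone S _) X⊆B ∣B∣≤s others =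
    <⇒≱ (⊤⊆p⇒s<∣p∣ (drop-∷-⊆ (others base∈ (λ ()) (out⊆ ⊆⊤)))) (≤-trans (∣p∣≤∣x∷p∣ b B′) ∣B∣≤s)
  no-step-below {X = inside ∷ X′} {outside ∷ B′} (isCone S _) X⊆B ∣B∣≤s others with X⊆B here
  ... | ()
  no-step-below {X = inside ∷ X′} {inside ∷ B′} (isCone S _) X⊆B ∣B∣≤s others
    with escape S (drop-∷-⊆ X⊆B) ∣B∣≤s
  ... | T , X′⊆T , ∣T∣≡s , T≢S , T⊈B′ =
    T⊈B′ (drop-∷-⊆ (others (cone∈ ∣T∣≡s) (λ T≡S → T≢S (cong tail T≡S)) (in⊆in X′⊆T)))

  small-stable : ∀ B → ∣ B ∣ ≤ s → Stable H B
  small-stable B ∣B∣≤s E∈ _ _ X⊆B others =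
    ⊥-elim (no-step-below (isEdge E∈) X⊆B ∣B∣≤s others)

  threshold : Threshold H s
  threshold = record { large-forces = large-forces ; small-stable = small-stable }

threshold-hypergraph : ∀ n s → s < n → Σ (Hypergraph n) λ H → Threshold H s
threshold-hypergraph (suc m) zero    _ = singleEdge (suc m) , singleEdge-threshold (suc m)
threshold-hypergraph (suc m) (suc s) s<n with suc s <? m
... | yes s<m = Cone.H m (suc s) (s≤s z≤n) s<m , Cone.threshold m (suc s) (s≤s z≤n) s<m
... | no  s≮m = subst (λ t → Σ (Hypergraph (suc m)) λ H → Threshold H t)
                  (≤-antisym (≮⇒≥ s≮m) (≤-pred s<n)) (noEdges (suc m) , noEdges-threshold m)

theorem2 : (n k : ℕ) → 1 ≤ k → k ≤ n →
    Σ (Hypergraph n) (λ H → F₂≡U H k) × Σ (Hypergraph n) (λ H′ → I₂≡U H′ k)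
theorem2 n (suc s) 1≤k k≤n
  with threshold-hypergraph n s k≤n
     | threshold-hypergraph n (n ∸ suc s) (∸-monoʳ-< {o = 0} (s≤s z≤n) k≤n)
... | H , threshold | H′ , threshold′ =
  (H , threshold⇒F₂≡U H s k≤n threshold) , (H′ , threshold⇒I₂≡U H′ (suc s) 1≤k k≤n threshold′)
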